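{- Let $X\subseteq\mathcal{P}(\mathbb{N})$ be closed under enumeration equivalence and $f\colon X\to\mathcal{P}(\mathbb{N})$ be uniformly $e$-invariant. For any $A,B\in X$ such that $f(A)\neq f(B)$, we have $f(A\oplus\varnothing)\neq f(B\oplus\varnothing)$ and $f(\varnothing\oplus A)\neq f(\varnothing\oplus B)$.
   Context: $A\oplus B=\{2n\mid n\in A\}\cup\{2n+1\mid n\in B\}$. $\{\Gamma_i\}$ is the standard numbering of c.e. sets viewed as enumeration operators, $\Gamma_i(B)=\{x\mid \exists D\text{ finite},\ D\subseteq B,\ \langle x,D\rangle\in\Gamma_i\}$; $\equiv_e$ is enumeration equivalence (note $A\oplus\varnothing\equiv_e A\equiv_e\varnothing\oplus A$). $A\equiv_e B$ via $\langle i,j\rangle$ means $\Gamma_i(A)=B$ and $\Gamma_j(B)=A$. $f$ is uniformly $e$-invariant if there is $u\colon\mathbb{N}\to\mathbb{N}$ such that for $A,B\in X$, $A\equiv_e B$ via $\langle i,j\rangle$ implies $f(A)\equiv_e f(B)$ via $u(\langle i,j\rangle)$. -}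

module Defs where

open import Data.Nat using (ℕ; zero; suc; _+_; _*_; _<_; _^_; _≡ᵇ_)
open import Data.Nat.DivMod using (_/_; _%_)
open import Data.Fin using (Fin)
open import Data.Vec using (Vec; []; _∷_; lookup)
open import Data.Product using (Σ; ∃; _×_; _,_)
open import Data.Empty using (⊥)
open import Relation.Nullary using (¬_)
open import Relation.Binary.PropositionalEquality using (_≡_)

SetN : Set₁
SetN = ℕ → Set

_≐_ : SetN → SetN → Set
A ≐ B = ∀ x → (A x → B x) × (B x → A x)

⟨_,_⟩ : ℕ → ℕ → ℕ
⟨ x , y ⟩ = ((x + y) * suc (x + y)) / 2 + y

-- Canonical index of finite sets: k ∈ D_n iff the k-th binary digit of n is 1.
bit : ℕ → ℕ → ℕ
bit n zero    = n % 2
bit n (suc k) = bit (n / 2) k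

_∈D_ : ℕ → ℕ → Set
k ∈D n = bit n k ≡ 1

∅ : SetN
∅ _ = ⊥

data _⊕_ (A B : SetN) : SetN where
  left  : ∀ {n} → A n → (A ⊕ B) (2 * n)
  right : ∀ {n} → B n → (A ⊕ B) (suc (2 * n))

-- Codes for partial (μ-)recursive functions of arity n.
data PR : ℕ → Set where
  Zc : ∀ {n} → PR n
  Sc : PR 1
  Pc : ∀ {n} → Fin n → PR n
  Cc : ∀ {n m} → PR m → Vec (PR n) m → PR n
  Rc : ∀ {n} → PR n → PR (suc (suc n)) → PR (suc n)
  Mc : ∀ {n} → PR (suc n) → PR n

mutual
  data Eval : ∀ {n} → PR n → Vec ℕ n → ℕ → Set where
    eZ : ∀ {n} {xs : Vec ℕ n} → Eval Zc xs 0
    eS : ∀ {x} → Eval Sc (x ∷ []) (suc x)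
    eP : ∀ {n} {i : Fin n} {xs} → Eval (Pc i) xs (lookup xs i)
    eC : ∀ {n m} {g : PR m} {hs : Vec (PR n) m} {xs ys y} →
         EvalV hs xs ys → Eval g ys y → Eval (Cc g hs) xs y
    eR0 : ∀ {n} {g : PR n} {h xs y} → Eval g xs y → Eval (Rc g h) (0 ∷ xs) y
    eRs : ∀ {n} {g : PR n} {h xs k r y} →
          Eval (Rc g h) (k ∷ xs) r → Eval h (k ∷ r ∷ xs) y →
          Eval (Rc g h) (suc k ∷ xs) y
    eM : ∀ {n} {f : PR (suc n)} {xs y} →
         Eval f (y ∷ xs) 0 →
         (∀ z → z < y → ∃ λ v → Eval f (z ∷ xs) (suc v)) →
         Eval (Mc f) xs y

  data EvalV : ∀ {n m} → Vec (PR n) m → Vec ℕ n → Vec ℕ m → Set where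
    []  : ∀ {n} {xs : Vec ℕ n} → EvalV [] xs []
    _∷_ : ∀ {n m} {h : PR n} {hs : Vec (PR n) m} {xs y ys} →
          Eval h xs y → EvalV hs xs ys → EvalV (h ∷ hs) xs (y ∷ ys)

Index : Set
Index = PR 1

W : Index → SetN
W e x = ∃ λ y → Eval e (x ∷ []) y

Γ : Index → SetN → SetN
Γ i B x = ∃ λ d → W i ⟨ x , d ⟩ × (∀ k → k ∈D d → B k)

_≡e_via_ : SetN → SetN → Index × Index → Set
A ≡e B via (i , j) = (Γ i A ≐ B) × (Γ j B ≐ A)

_≡e_ : SetN → SetN → Set
A ≡e B = Σ (Index × Index) λ p → A ≡e B via p

ClosedUnder≡e : (SetN → Set) → Set₁
ClosedUnder≡e X = ∀ A B → X A → A ≡e B → X B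

UniformlyEInvariant : (X : SetN → Set) → ((A : SetN) → X A → SetN) → Set₁
UniformlyEInvariant X f =
  Σ (Index × Index → Index × Index) λ u →
    ∀ A B (a : X A) (b : X B) (p : Index × Index) →
      A ≡e B via p → f A a ≡e f B b via u p

{-# OPTIONS --safe #-}
-- The maps A ↦ A ⊕ ∅ and A ↦ ∅ ⊕ A are realised by enumeration equivalences whose
-- indices do not depend on A: one operator takes the image of A under n ↦ 2n (resp.
-- n ↦ 2n+1), the other the preimage.  A uniformly e-invariant f sends A ≡e A ⊕ ∅ and
-- B ≡e B ⊕ ∅ to equivalences via the same index pair, so f(A) = Γⱼ(f(A ⊕ ∅)) and
-- f(B) = Γⱼ(f(B ⊕ ∅)); hence f(A ⊕ ∅) = f(B ⊕ ∅) would force f(A) = f(B).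
module Submission where

open import Defs
open import Data.Product using (_×_)
open import Relation.Nullary using (¬_)

open import Data.Nat using (ℕ; zero; suc; pred; ≢-nonZero; _+_; _*_; _∸_; _^_; _<_; _≤_; ∣_-_∣; z≤n; s≤s; _≟_)
open import Data.Nat.Properties
open import Data.Nat.DivMod using (_/_; _%_; m*n/n≡m; m*n%n≡0)
open import Data.Nat.Induction using (<-wellFounded)
open import Data.Nat.Solver using (module +-*-Solver)
open import Data.Fin using () renaming (zero to fz; suc to fs)
open import Data.Vec using (Vec; _∷_; [])
open import Data.Product using (∃; _,_; proj₁; proj₂)
open import Data.Empty using (⊥-elim)
open import Function using (id; _∘_)
open import Function.Definitions using (Injective)
open import Induction.WellFounded using (Acc; acc)
open import Relation.Nullary using (Dec; yes; no)
open import Relation.Binary using (tri<; tri≈; tri>)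
open import Relation.Binary.PropositionalEquality

mutual
  Eval-deterministic : ∀ {n} {f : PR n} {xs y y′} → Eval f xs y → Eval f xs y′ → y ≡ y′
  Eval-deterministic eZ eZ = refl
  Eval-deterministic eS eS = refl
  Eval-deterministic eP eP = refl
  Eval-deterministic (eC es e) (eC es′ e′) with EvalV-deterministic es es′
  ... | refl = Eval-deterministic e e′
  Eval-deterministic (eR0 e) (eR0 e′) = Eval-deterministic e e′
  Eval-deterministic (eRs r e) (eRs r′ e′) with Eval-deterministic r r′
  ... | refl = Eval-deterministic e e′
  Eval-deterministic {y = y} {y′} (eM e below) (eM e′ below′) with <-cmp y y′
  ... | tri< y<y′ _ _ = ⊥-elim (0≢1+n (Eval-deterministic e (proj₂ (below′ y y<y′))))
  ... | tri≈ _ y≡y′ _ = y≡y′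
  ... | tri> _ _ y′<y = ⊥-elim (0≢1+n (Eval-deterministic e′ (proj₂ (below y′ y′<y))))

  EvalV-deterministic : ∀ {n m} {hs : Vec (PR n) m} {xs ys ys′} →
                        EvalV hs xs ys → EvalV hs xs ys′ → ys ≡ ys′
  EvalV-deterministic [] [] = refl
  EvalV-deterministic (e ∷ es) (e′ ∷ es′) =
    cong₂ _∷_ (Eval-deterministic e e′) (EvalV-deterministic es es′)

_computes_ : PR 1 → (ℕ → ℕ) → Set
c computes h = ∀ y → Eval c (y ∷ []) (h y)

identityCode : PR 1
identityCode = Pc fz

identityCode-computes : identityCode computes id
identityCode-computes _ = eP

addCode : PR 2
addCode = Rc (Pc fz) (Cc Sc (Pc (fs fz) ∷ []))

eval-addCode : ∀ k a → Eval addCode (k ∷ a ∷ []) (k + a)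
eval-addCode zero    a = eR0 eP
eval-addCode (suc k) a = eRs (eval-addCode k a) (eC (eP ∷ []) eS)

predCode : PR 1
predCode = Rc Zc (Pc fz)

predCode-computes : predCode computes pred
predCode-computes zero    = eR0 eZ
predCode-computes (suc k) = eRs (predCode-computes k) eP

monusCode : PR 2
monusCode = Rc (Pc fz) (Cc predCode (Pc (fs fz) ∷ []))

eval-monusCode : ∀ k a → Eval monusCode (k ∷ a ∷ []) (a ∸ k)
eval-monusCode zero    a = eR0 eP
eval-monusCode (suc k) a =
  subst (Eval monusCode _) (pred[m∸n]≡m∸[1+n] a k)
        (eRs (eval-monusCode k a) (eC (eP ∷ []) (predCode-computes (a ∸ k))))

∸+∸≡∣-∣ : ∀ m n → (m ∸ n) + (n ∸ m) ≡ ∣ m - n ∣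
∸+∸≡∣-∣ zero    zero    = refl
∸+∸≡∣-∣ zero    (suc n) = refl
∸+∸≡∣-∣ (suc m) zero    = +-identityʳ (suc m)
∸+∸≡∣-∣ (suc m) (suc n) = ∸+∸≡∣-∣ m n

distanceCode : PR 2
distanceCode = Cc addCode ( Cc monusCode (Pc (fs fz) ∷ Pc fz ∷ [])
                          ∷ Cc monusCode (Pc fz ∷ Pc (fs fz) ∷ []) ∷ [])

eval-distanceCode : ∀ a b → Eval distanceCode (a ∷ b ∷ []) ∣ a - b ∣
eval-distanceCode a b =
  subst (Eval distanceCode _) (∸+∸≡∣-∣ a b)
        (eC (eC (eP ∷ eP ∷ []) (eval-monusCode b a) ∷ eC (eP ∷ eP ∷ []) (eval-monusCode a b) ∷ [])
            (eval-addCode _ _))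

doubleCode : PR 1
doubleCode = Cc addCode (Pc fz ∷ Pc fz ∷ [])

doubleCode-computes : doubleCode computes (2 *_)
doubleCode-computes y =
  subst (Eval doubleCode _) (cong (y +_) (sym (+-identityʳ y))) (eC (eP ∷ eP ∷ []) (eval-addCode y y))

oddCode : PR 1
oddCode = Cc Sc (doubleCode ∷ [])

oddCode-computes : oddCode computes (suc ∘ (2 *_))
oddCode-computes y = eC (doubleCode-computes y ∷ []) eS

pow2Code : PR 1
pow2Code = Rc (Cc Sc (Zc ∷ [])) (Cc doubleCode (Pc (fs fz) ∷ []))

pow2Code-computes : pow2Code computes (2 ^_)
pow2Code-computes zero    = eR0 (eC (eZ ∷ []) eS)
pow2Code-computes (suc k) =
  eRs (pow2Code-computes k) (eC (eP ∷ []) (doubleCode-computes (2 ^ k)))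

triangle : ℕ → ℕ
triangle zero    = zero
triangle (suc k) = suc k + triangle k

triangleCode : PR 1
triangleCode = Rc Zc (Cc addCode (Cc Sc (Pc fz ∷ []) ∷ Pc (fs fz) ∷ []))

triangleCode-computes : triangleCode computes triangle
triangleCode-computes zero    = eR0 eZ
triangleCode-computes (suc k) =
  eRs (triangleCode-computes k) (eC (eC (eP ∷ []) eS ∷ eP ∷ []) (eval-addCode _ _))

n*[1+n]≡triangle*2 : ∀ n → n * suc n ≡ triangle n * 2
n*[1+n]≡triangle*2 zero    = refl
n*[1+n]≡triangle*2 (suc n) = begin
  suc n * suc (suc n)          ≡⟨ solve 1 (λ n → (con 1 :+ n) :* (con 2 :+ n)
                                                  := (con 1 :+ n) :* con 2 :+ n :* (con 1 :+ n)) refl n ⟩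
  suc n * 2 + n * suc n        ≡⟨ cong (suc n * 2 +_) (n*[1+n]≡triangle*2 n) ⟩
  suc n * 2 + triangle n * 2   ≡⟨ *-distribʳ-+ 2 (suc n) (triangle n) ⟨
  triangle (suc n) * 2         ∎
  where open ≡-Reasoning
        open +-*-Solver using (solve; _:+_; _:*_; _:=_; con)

⟨,⟩≡triangle : ∀ x d → ⟨ x , d ⟩ ≡ triangle (x + d) + d
⟨,⟩≡triangle x d = cong (_+ d) (trans (cong (_/ 2) (n*[1+n]≡triangle*2 (x + d))) (m*n/n≡m (triangle (x + d)) 2))

triangle-mono-≤ : ∀ {m n} → m ≤ n → triangle m ≤ triangle n
triangle-mono-≤ z≤n       = z≤n
triangle-mono-≤ (s≤s m≤n) = s≤s (+-mono-≤ m≤n (triangle-mono-≤ m≤n))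

-- Each diagonal x + d = s occupies the interval [triangle s, triangle s + s].
⟨,⟩-<-diagonal : ∀ x d x′ d′ → x + d < x′ + d′ → ⟨ x , d ⟩ < ⟨ x′ , d′ ⟩
⟨,⟩-<-diagonal x d x′ d′ s<s′ = begin-strict
  ⟨ x , d ⟩                  ≡⟨ ⟨,⟩≡triangle x d ⟩
  triangle s + d             ≤⟨ +-monoʳ-≤ (triangle s) (m≤n+m d x) ⟩
  triangle s + s             ≡⟨ +-comm (triangle s) s ⟩
  s + triangle s             <⟨ n<1+n _ ⟩
  triangle (suc s)           ≤⟨ triangle-mono-≤ s<s′ ⟩
  triangle (x′ + d′)         ≤⟨ m≤m+n _ d′ ⟩
  triangle (x′ + d′) + d′    ≡⟨ ⟨,⟩≡triangle x′ d′ ⟨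
  ⟨ x′ , d′ ⟩                ∎
  where open ≤-Reasoning
        s = x + d

⟨,⟩-injective : ∀ x d x′ d′ → ⟨ x , d ⟩ ≡ ⟨ x′ , d′ ⟩ → x ≡ x′ × d ≡ d′
⟨,⟩-injective x d x′ d′ eq with <-cmp (x + d) (x′ + d′)
... | tri< s<s′ _ _ = ⊥-elim (<-irrefl eq (⟨,⟩-<-diagonal x d x′ d′ s<s′))
... | tri> _ _ s′<s = ⊥-elim (<-irrefl (sym eq) (⟨,⟩-<-diagonal x′ d′ x d s′<s))
... | tri≈ _ s≡s′ _ = x≡x′ , d≡d′
  where
  d≡d′ : d ≡ d′
  d≡d′ = +-cancelˡ-≡ (triangle (x + d)) d d′ (begin
    triangle (x + d) + d       ≡⟨ ⟨,⟩≡triangle x d ⟨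
    ⟨ x , d ⟩                  ≡⟨ eq ⟩
    ⟨ x′ , d′ ⟩                ≡⟨ ⟨,⟩≡triangle x′ d′ ⟩
    triangle (x′ + d′) + d′    ≡⟨ cong (λ s → triangle s + d′) s≡s′ ⟨
    triangle (x + d) + d′      ∎)
    where open ≡-Reasoning
  x≡x′ : x ≡ x′
  x≡x′ = +-cancelʳ-≡ d x x′ (trans s≡s′ (cong (x′ +_) (sym d≡d′)))

pairCode : PR 2
pairCode = Cc addCode (Cc triangleCode (addCode ∷ []) ∷ Pc (fs fz) ∷ [])

eval-pairCode : ∀ x d → Eval pairCode (x ∷ d ∷ []) ⟨ x , d ⟩
eval-pairCode x d =
  subst (Eval pairCode _) (sym (⟨,⟩≡triangle x d))
        (eC (eC (eval-addCode x d ∷ []) (triangleCode-computes (x + d)) ∷ eP ∷ []) (eval-addCode _ _))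

bit-0 : ∀ k → bit 0 k ≡ 0
bit-0 zero    = refl
bit-0 (suc k) = bit-0 k

2*n/2≡n : ∀ n → 2 * n / 2 ≡ n
2*n/2≡n n = trans (cong (_/ 2) (*-comm 2 n)) (m*n/n≡m n 2)

2*n%2≡0 : ∀ n → 2 * n % 2 ≡ 0
2*n%2≡0 n = trans (cong (_% 2) (*-comm 2 n)) (m*n%n≡0 n 2)

∈D-2^ : ∀ k → k ∈D (2 ^ k)
∈D-2^ zero    = refl
∈D-2^ (suc k) = trans (cong (λ n → bit n k) (2*n/2≡n (2 ^ k))) (∈D-2^ k)

∈D-2^⇒≡ : ∀ {k} K → k ∈D (2 ^ K) → k ≡ K
∈D-2^⇒≡ {zero}  zero    _   = refl
∈D-2^⇒≡ {suc k} zero    k∈D = ⊥-elim (0≢1+n (trans (sym (bit-0 k)) k∈D))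
∈D-2^⇒≡ {zero}  (suc K) k∈D = ⊥-elim (0≢1+n (trans (sym (2*n%2≡0 (2 ^ K))) k∈D))
∈D-2^⇒≡ {suc k} (suc K) k∈D =
  cong suc (∈D-2^⇒≡ K (trans (cong (λ n → bit n k) (sym (2*n/2≡n (2 ^ K)))) k∈D))

Minimal : (ℕ → Set) → Set
Minimal P = ∃ λ z → P z × (∀ w → w < z → ¬ P w)

minimal-witness : {P : ℕ → Set} → (∀ n → Dec (P n)) → ∀ {n} → P n → Minimal P
minimal-witness {P} P? = go (<-wellFounded _)
  where
  go : ∀ {n} → Acc _<_ n → P n → Minimal P
  go {n} (acc smaller) Pn with anyUpTo? P? n
  ... | yes (m , m<n , Pm) = go (smaller m<n) Pm
  ... | no none            = n , Pn , λ w w<n Pw → none (w , w<n , Pw)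

-- The μ-search for the least y with ∣ m - q y ∣ = 0 halts exactly on the range of q.
rangeSearchCode : PR 1 → PR 2
rangeSearchCode q = Cc distanceCode (Pc (fs fz) ∷ Cc q (Pc fz ∷ []) ∷ [])

rangeCode : PR 1 → Index
rangeCode q = Mc (rangeSearchCode q)

module _ {qᶜ : PR 1} {q : ℕ → ℕ} (qᶜ-computes : qᶜ computes q) where

  private
    F : PR 2
    F = rangeSearchCode qᶜ

    eval-F : ∀ y m → Eval F (y ∷ m ∷ []) ∣ m - q y ∣
    eval-F y m = eC (eP ∷ eC (eP ∷ []) (qᶜ-computes y) ∷ []) (eval-distanceCode m (q y))

  W-rangeCode⁻ : ∀ {m} → W (rangeCode qᶜ) m → ∃ λ y → m ≡ q y
  W-rangeCode⁻ {m} (y , eM F[y,m]≡0 _) = y , ∣m-n∣≡0⇒m≡n (Eval-deterministic (eval-F y m) F[y,m]≡0)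

  W-rangeCode⁺ : ∀ {m y} → m ≡ q y → W (rangeCode qᶜ) m
  W-rangeCode⁺ {m} m≡qy with minimal-witness (λ z → m ≟ q z) m≡qy
  ... | z , m≡qz , below = z , eM (subst (Eval F _) (m≡n⇒∣m-n∣≡0 m≡qz) (eval-F z m)) positive
    where
    positive : ∀ w → w < z → ∃ λ v → Eval F (w ∷ m ∷ []) (suc v)
    positive w w<z = pred ∣ m - q w ∣ , subst (Eval F _) (sym (suc-pred _ {{nonZero}})) (eval-F w m)
      where nonZero = ≢-nonZero (below w w<z ∘ ∣m-n∣≡0⇒m≡n)

ImageOfPreimage : (ℕ → ℕ) → (ℕ → ℕ) → SetN → SetN
ImageOfPreimage g h B x = ∃ λ y → x ≡ g y × B (h y)

-- W lists the axioms ⟨g y , {h y}⟩, the canonical index of the singleton {h y} being 2 ^ h y.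
operatorCode : PR 1 → PR 1 → Index
operatorCode gᶜ hᶜ = rangeCode (Cc pairCode (gᶜ ∷ Cc pow2Code (hᶜ ∷ []) ∷ []))

module _ {gᶜ hᶜ : PR 1} {g h : ℕ → ℕ} (gᶜ-computes : gᶜ computes g) (hᶜ-computes : hᶜ computes h) where

  private
    axiom : ℕ → ℕ
    axiom y = ⟨ g y , 2 ^ h y ⟩

    axiom-computes : Cc pairCode (gᶜ ∷ Cc pow2Code (hᶜ ∷ []) ∷ []) computes axiom
    axiom-computes y =
      eC (gᶜ-computes y ∷ eC (hᶜ-computes y ∷ []) (pow2Code-computes (h y)) ∷ []) (eval-pairCode _ _)

  Γ-operatorCode : ∀ B → Γ (operatorCode gᶜ hᶜ) B ≐ ImageOfPreimage g h B
  Γ-operatorCode B x = to , from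
    where
    to : Γ (operatorCode gᶜ hᶜ) B x → ImageOfPreimage g h B x
    to (d , w , D⊆B) with W-rangeCode⁻ axiom-computes w
    ... | y , eq with ⟨,⟩-injective x d (g y) (2 ^ h y) eq
    ... | x≡gy , refl = y , x≡gy , D⊆B (h y) (∈D-2^ (h y))

    from : ImageOfPreimage g h B x → Γ (operatorCode gᶜ hᶜ) B x
    from (y , refl , Bhy) = 2 ^ h y , W-rangeCode⁺ axiom-computes refl
                          , λ k k∈D → subst B (sym (∈D-2^⇒≡ (h y) k∈D)) Bhy

≐-sym : ∀ {A B} → A ≐ B → B ≐ A
≐-sym A≐B x = proj₂ (A≐B x) , proj₁ (A≐B x)

≐-trans : ∀ {A B C} → A ≐ B → B ≐ C → A ≐ C
≐-trans A≐B B≐C x = proj₁ (B≐C x) ∘ proj₁ (A≐B x) , proj₂ (A≐B x) ∘ proj₂ (B≐C x)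

Γ-mono : ∀ i {A B} → (∀ x → A x → B x) → ∀ x → Γ i A x → Γ i B x
Γ-mono i A⊆B x (d , w , D⊆A) = d , w , λ k k∈D → A⊆B k (D⊆A k k∈D)

Γ-resp-≐ : ∀ i {A B} → A ≐ B → Γ i A ≐ Γ i B
Γ-resp-≐ i A≐B x = Γ-mono i (proj₁ ∘ A≐B) x , Γ-mono i (proj₂ ∘ A≐B) x

≡e-via-resp-≐ʳ : ∀ {A B C p} → B ≐ C → A ≡e B via p → A ≡e C via p
≡e-via-resp-≐ʳ {p = i , j} B≐C (ΓiA≐B , ΓjB≐A) = ≐-trans ΓiA≐B B≐C , ≐-trans (Γ-resp-≐ j (≐-sym B≐C)) ΓjB≐A

Image : (ℕ → ℕ) → SetN → SetN
Image h = ImageOfPreimage h id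

imageIndices : PR 1 → Index × Index
imageIndices hᶜ = operatorCode hᶜ identityCode , operatorCode identityCode hᶜ

≡e-Image : ∀ {hᶜ h} → hᶜ computes h → Injective _≡_ _≡_ h → ∀ A → A ≡e Image h A via imageIndices hᶜ
≡e-Image {hᶜ} {h} hᶜ-computes h-injective A =
    Γ-operatorCode hᶜ-computes identityCode-computes A
  , ≐-trans (Γ-operatorCode identityCode-computes hᶜ-computes (Image h A)) preimage-of-image
  where
  preimage-of-image : ImageOfPreimage id h (Image h A) ≐ A
  preimage-of-image x = (λ { (_ , refl , (y , hx≡hy , Ay)) → subst A (sym (h-injective hx≡hy)) Ay })
                      , (λ Ax → x , refl , x , refl , Ax)

⊕∅≐Image : ∀ A → (A ⊕ ∅) ≐ Image (2 *_) A
⊕∅≐Image A x = (λ { (left {y} Ay) → y , refl , Ay }) , (λ { (y , refl , Ay) → left Ay })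

∅⊕≐Image : ∀ A → (∅ ⊕ A) ≐ Image (suc ∘ (2 *_)) A
∅⊕≐Image A x = (λ { (right {y} Ay) → y , refl , Ay }) , (λ { (y , refl , Ay) → right Ay })

2*-injective : Injective _≡_ _≡_ (2 *_)
2*-injective {x} {y} = *-cancelˡ-≡ x y 2

≡e-⊕∅ : ∀ A → A ≡e (A ⊕ ∅) via imageIndices doubleCode
≡e-⊕∅ A = ≡e-via-resp-≐ʳ (≐-sym (⊕∅≐Image A)) (≡e-Image doubleCode-computes 2*-injective A)

≡e-∅⊕ : ∀ A → A ≡e (∅ ⊕ A) via imageIndices oddCode
≡e-∅⊕ A = ≡e-via-resp-≐ʳ (≐-sym (∅⊕≐Image A)) (≡e-Image oddCode-computes (2*-injective ∘ suc-injective) A)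

uniformlyEInvariant-reflects-≐ : ∀ {X f} → UniformlyEInvariant X f →
  ∀ {A A′ B B′ p} → A ≡e A′ via p → B ≡e B′ via p →
  ∀ a a′ b b′ → f A′ a′ ≐ f B′ b′ → f A a ≐ f B b
uniformlyEInvariant-reflects-≐ (u , invariant) {p = p} A≡A′ B≡B′ a a′ b b′ fA′≐fB′ =
  ≐-trans (≐-sym (proj₂ (invariant _ _ a a′ p A≡A′)))
          (≐-trans (Γ-resp-≐ (proj₂ (u p)) fA′≐fB′) (proj₂ (invariant _ _ b b′ p B≡B′)))

lemma5p2 : (X : SetN → Set) (f : (A : SetN) → X A → SetN) →
    ClosedUnder≡e X → UniformlyEInvariant X f →
    ∀ A B (a : X A) (b : X B) → ¬ (f A a ≐ f B b) →
    (∀ (a' : X (A ⊕ ∅)) (b' : X (B ⊕ ∅)) → ¬ (f (A ⊕ ∅) a' ≐ f (B ⊕ ∅) b'))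
    × (∀ (a' : X (∅ ⊕ A)) (b' : X (∅ ⊕ B)) → ¬ (f (∅ ⊕ A) a' ≐ f (∅ ⊕ B) b'))
lemma5p2 _ _ _ f-invariant A B a b fA≭fB =
    (λ a′ b′ → fA≭fB ∘ uniformlyEInvariant-reflects-≐ f-invariant (≡e-⊕∅ A) (≡e-⊕∅ B) a a′ b b′)
  , (λ a′ b′ → fA≭fB ∘ uniformlyEInvariant-reflects-≐ f-invariant (≡e-∅⊕ A) (≡e-∅⊕ B) a a′ b b′)
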